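{- Let $(V,\mathcal{B})$ be a $(v,k,1)$-BIBD with well-distributed minimal sub-BIBDs with parameter $m$ (number of minimal sub-BIBDs containing each block), whose minimal sub-BIBDs are $(v',k,1)$-BIBDs. Suppose that $v<\frac{(v'-1)^{2}}{k-1}+1$. Then $$m\leq\frac{\frac{v'-k}{k-1}}{\frac{v'-1}{k-1}-\frac{v-1}{v'-1}}.$$
   Context: A $(v,k,\lambda)$-BIBD is a pair $(V,\mathcal{B})$ where $V$ is a finite set of $v$ points and $\mathcal{B}$ is a set (no repeated blocks) of $k$-subsets of $V$, $k>1$, such that every pair of distinct points lies in exactly $\lambda$ blocks; trivial cases are excluded. A sub-BIBD of a $(v,k,1)$-BIBD $(V,\mathcal{B})$ is a pair $(V',\mathcal{B}')$ with $V'\subseteq V$, $\mathcal{B}'\subseteq\{B\in\mathcal{B}:B\subseteq V'\}$, which is itself a $(v',k,1)$-BIBD. A sub-BIBD is minimal if $v'$ is minimal among all sub-BIBDs with $v'>k$. $(V,\mathcal{B})$ has well-distributed minimal sub-BIBDs if there are integers $l,m$ such that every point lies in exactly $l$ minimal sub-BIBDs and every block lies in exactly $m$ minimal sub-BIBDs. -}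

module Defs where

open import Data.Nat using (ℕ; _<_; _≤_)
open import Data.Fin using (Fin)
open import Data.Fin.Subset using (Subset; _∈_; _⊆_; ∣_∣; ⊤)
open import Data.Fin.Subset.Properties using (_∈?_)
open import Data.List using (List; length; filter; allFin)
open import Data.List.Relation.Unary.Unique.Propositional using (Unique)
import Data.List.Membership.Propositional as L
open import Data.Product using (Σ; _×_; proj₁; proj₂)
open import Relation.Nullary.Decidable using (_×-dec_)
open import Relation.Binary.PropositionalEquality using (_≡_; _≢_)
open import Function.Definitions using (Injective)
open import Function.Bundles using (_⇔_)

-- A design on the point set Fin v with b blocks, given as an indexed
-- family  blocks : Fin b → Subset v  (injective = no repeated blocks).

pairCount : ∀ {v b} → (Fin b → Subset v) → Subset b → Fin v → Fin v → ℕ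
pairCount {v} {b} blocks B' x y =
  length (filter (λ i → i ∈? B' ×-dec (x ∈? blocks i ×-dec y ∈? blocks i)) (allFin b))

-- (v,k,λ)-BIBD, trivial cases (k = v) excluded: 1 < k < v
record IsBIBD (v k lam b : ℕ) (blocks : Fin b → Subset v) : Set where
  field
    k>1       : 1 < k
    k<v       : k < v
    noRepeat  : Injective _≡_ _≡_ blocks
    blockSize : ∀ i → ∣ blocks i ∣ ≡ k
    balanced  : ∀ x y → x ≢ y → pairCount blocks ⊤ x y ≡ lam

SubCand : ℕ → ℕ → Set
SubCand v b = Subset v × Subset b

-- (V',B') is a sub-BIBD (λ = 1): every block of B' lies inside V', and
-- every pair of distinct points of V' lies in exactly one block of B'.
-- (Block size k is inherited from the ambient design.)
IsSubBIBD : ∀ {v b} → (Fin b → Subset v) → SubCand v b → Set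
IsSubBIBD blocks S =
  (∀ i → i ∈ proj₂ S → blocks i ⊆ proj₁ S) ×
  (∀ x y → x ∈ proj₁ S → y ∈ proj₁ S → x ≢ y → pairCount blocks (proj₂ S) x y ≡ 1)

IsMinimalSub : ∀ {v b} → ℕ → (Fin b → Subset v) → SubCand v b → Set
IsMinimalSub k blocks S =
  IsSubBIBD blocks S × k < ∣ proj₁ S ∣ ×
  (∀ S' → IsSubBIBD blocks S' → k < ∣ proj₁ S' ∣ → ∣ proj₁ S ∣ ≤ ∣ proj₁ S' ∣)

Exactly : ∀ {A : Set} → (A → Set) → ℕ → Set
Exactly {A} P n = Σ (List A) λ xs → Unique xs × (∀ a → (a L.∈ xs) ⇔ P a) × length xs ≡ n

WellDistributed : ∀ {v b} → ℕ → (Fin b → Subset v) → ℕ → ℕ → Set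
WellDistributed k blocks l m =
  (∀ x → Exactly (λ S → IsMinimalSub k blocks S × x ∈ proj₁ S) l) ×
  (∀ i → Exactly (λ S → IsMinimalSub k blocks S × i ∈ proj₂ S) m)

module Submission where

-- Fix a point x and let T range over the l minimal sub-BIBDs through x.
--  * Degree: every other point y lies in exactly m of them, namely those
--    containing the unique block through x and y.
--  * Meet: two distinct minimal sub-BIBDs share at most k points, since their
--    intersection is again a sub-BIBD and minimality would force both to equal it.
-- Double counting the pairs (T, y), y ≠ x a point of q ∩ T, gives
--    l (v'-1) = m (v-1)                      for q the whole point set, and
--    m (v'-1) ≤ (v'-1) + (k-1)(l-1)          for q a minimal S through x.
-- Multiplying the second by v'-1 and substituting the first yields the bound.

open import Defs
open import Data.Fin using (Fin; zero; suc; fromℕ<)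
open import Data.Fin.Properties using (_≟_)
open import Data.Fin.Subset using (Subset; inside; outside; _∈_; _⊆_; ∣_∣; Nonempty; _∩_; ⊤)
open import Data.Fin.Subset.Properties
  using ( _∈?_; drop-there; nonempty?; Empty-unique; ∣⊥∣≡0; p⊂q⇒∣p∣<∣q∣; ⊆-antisym; ∈⊤; ∣⊤∣≡n
        ; x∈p∩q⁺; x∈p∩q⁻; p∩q⊆p; p∩q⊆q; ∣p∩q∣≤∣p∣; ∩-identityˡ )
open import Data.List using (List; []; _∷_; length; filter; map; tabulate; allFin)
open import Data.List.Properties using (map-cong)
open import Data.List.Membership.Propositional using () renaming (_∈_ to _∈ₗ_)
open import Data.List.Membership.Propositional.Properties using (∈-filter⁺; ∈-filter⁻; ∈-length; ∈-allFin)
open import Data.List.Membership.Propositional.Properties.WithK using (unique∧set⇒bag)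
open import Data.List.Relation.Binary.BagAndSetEquality using (∼bag⇒↭)
open import Data.List.Relation.Binary.Permutation.Propositional.Properties using (↭-length)
open import Data.List.Relation.Unary.Any using (here; there)
import Data.List.Relation.Unary.All as All
open import Data.List.Relation.Unary.Unique.Propositional using (Unique; _∷_)
open import Data.List.Relation.Unary.Unique.Propositional.Properties using (allFin⁺; filter⁺)
open import Data.Nat using (ℕ; zero; suc; _+_; _*_; _∸_; _^_; _≤_; _<_; z≤n; s≤s; >-nonZero)
open import Data.Nat.ListAction using (sum)
open import Data.Nat.Properties
  using ( +-assoc; +-comm; *-zeroʳ; *-suc; *-identityʳ; +-mono-≤; +-monoˡ-≤; *-monoˡ-≤
        ; ≤-reflexive; ≤-trans; ≤-antisym; <-trans; <⇒≤; ≰⇒>; >⇒≢; ≤⇒≯; m≤n⇒m≤1+n; _≤?_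
        ; m+n∸n≡m; ∸-monoˡ-≤; ∸-+-assoc; [m+n]∸[m+o]≡n∸o; m+[n∸m]≡n; m<n⇒0<n∸m
        ; *-distribˡ-∸; *-distribʳ-∸; m*n≡0⇒m≡0; n≢0⇒n>0; +-commutativeSemigroup
        ; module ≤-Reasoning )
  renaming (_≟_ to _≟ℕ_)
open import Algebra.Properties.CommutativeSemigroup +-commutativeSemigroup using (interchange; x∙yz≈y∙xz)
open import Data.Nat.Tactic.RingSolver using (solve-∀)
open import Data.Product using (∃; ∃₂; _×_; _,_; proj₁; proj₂)
import Data.Product as Product
open import Data.Sum using (_⊎_; inj₁; inj₂)
open import Data.Vec using ([]; _∷_) renaming (there to vthere)
open import Function.Base using (_∘_)
open import Function.Bundles using (_⇔_; mk⇔; Equivalence)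
open import Relation.Binary using (DecidableEquality)
open import Relation.Binary.PropositionalEquality
open import Relation.Nullary using (Dec; yes; no; ¬_; ¬?; contradiction)
open import Relation.Nullary.Decidable using (_×-dec_)

open Equivalence using (to; from)

count : {A : Set} {P : A → Set} → (∀ a → Dec (P a)) → List A → ℕ
count P? xs = length (filter P? xs)

indicator : {P : Set} → Dec P → ℕ
indicator (yes _) = 1
indicator (no _)  = 0

nonempty-list : {A : Set} {xs : List A} → 0 < length xs → ∃ λ a → a ∈ₗ xs
nonempty-list {xs = a ∷ _} _ = a , here refl

module _ {A : Set} {P : A → Set} (P? : ∀ a → Dec (P a)) where

  count-∷ : ∀ a xs → count P? (a ∷ xs) ≡ indicator (P? a) + count P? xs
  count-∷ a xs with P? a
  ... | yes _ = refl
  ... | no  _ = refl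

  -- A count is a sum of indicators; this is what makes double counting possible.
  count-as-sum : ∀ xs → count P? xs ≡ sum (map (λ a → indicator (P? a)) xs)
  count-as-sum []       = refl
  count-as-sum (a ∷ xs) = trans (count-∷ a xs) (cong (indicator (P? a) +_) (count-as-sum xs))

  count-witness : ∀ xs → 0 < count P? xs → ∃ λ a → a ∈ₗ xs × P a
  count-witness xs pos = Product.map₂ (∈-filter⁻ P?) (nonempty-list pos)

  count-member : ∀ {a xs} → a ∈ₗ xs → P a → 0 < count P? xs
  count-member a∈xs pa = ∈-length (∈-filter⁺ P? a∈xs pa)

  count-none : ∀ xs → (∀ a → a ∈ₗ xs → ¬ P a) → count P? xs ≡ 0
  count-none [] _ = refl
  count-none (a ∷ xs) none with P? a
  ... | yes pa = contradiction pa (none a (here refl))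
  ... | no  _  = count-none xs (λ b b∈xs → none b (there b∈xs))

module _ {A : Set} {P Q : A → Set} (P? : ∀ a → Dec (P a)) (Q? : ∀ a → Dec (Q a)) where

  count-mono : ∀ xs → (∀ a → a ∈ₗ xs → P a → Q a) → count P? xs ≤ count Q? xs
  count-mono []       _   = z≤n
  count-mono (a ∷ xs) P⇒Q with P? a | Q? a
  ... | yes pa | no ¬qa = contradiction (P⇒Q a (here refl) pa) ¬qa
  ... | yes _  | yes _  = s≤s (count-mono xs (λ b b∈xs → P⇒Q b (there b∈xs)))
  ... | no  _  | yes _  = m≤n⇒m≤1+n (count-mono xs (λ b b∈xs → P⇒Q b (there b∈xs)))
  ... | no  _  | no  _  = count-mono xs (λ b b∈xs → P⇒Q b (there b∈xs))

count-cong : {A : Set} {P Q : A → Set} (P? : ∀ a → Dec (P a)) (Q? : ∀ a → Dec (Q a)) →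
  ∀ xs → (∀ a → a ∈ₗ xs → P a → Q a) → (∀ a → a ∈ₗ xs → Q a → P a) →
  count P? xs ≡ count Q? xs
count-cong P? Q? xs P⇒Q Q⇒P = ≤-antisym (count-mono P? Q? xs P⇒Q) (count-mono Q? P? xs Q⇒P)

two-members : {A : Set} {a b : A} {xs : List A} → a ∈ₗ xs → b ∈ₗ xs → a ≢ b → 2 ≤ length xs
two-members (here refl)  (here refl)  a≢b = contradiction refl a≢b
two-members (here refl)  (there b∈xs) _   = s≤s (∈-length b∈xs)
two-members (there a∈xs) (here refl)  _   = s≤s (∈-length a∈xs)
two-members (there a∈xs) (there b∈xs) a≢b = m≤n⇒m≤1+n (two-members a∈xs b∈xs a≢b)

module _ {A : Set} (_≟_ : DecidableEquality A) {P : A → Set} (P? : ∀ a → Dec (P a)) where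

  count≤1⇒unique : ∀ {xs a b} → count P? xs ≤ 1 → a ∈ₗ xs → P a → b ∈ₗ xs → P b → a ≡ b
  count≤1⇒unique {xs} {a} {b} atMostOne a∈xs pa b∈xs pb with a ≟ b
  ... | yes a≡b = a≡b
  ... | no  a≢b = contradiction
        (≤-trans (two-members (∈-filter⁺ P? a∈xs pa) (∈-filter⁺ P? b∈xs pb) a≢b) atMostOne)
        λ { (s≤s ()) }

  count-remove : ∀ {x xs} → Unique xs → x ∈ₗ xs → P x →
    suc (count (λ y → P? y ×-dec ¬? (y ≟ x)) xs) ≡ count P? xs
  count-remove {x} {y ∷ ys} (y∉ys ∷ _) (here refl) px with P? y | y ≟ y
  ... | no ¬py | _       = contradiction px ¬py
  ... | yes _  | no y≢y  = contradiction refl y≢y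
  ... | yes _  | yes _   = cong suc (count-cong _ P? ys (λ _ _ → proj₁)
                             (λ a a∈ys pa → pa , λ a≡y → All.lookup y∉ys a∈ys (sym a≡y)))
  count-remove {x} {y ∷ ys} (y∉ys ∷ u) (there x∈ys) px with P? y | y ≟ x
  ... | _     | yes refl = contradiction refl (All.lookup y∉ys x∈ys)
  ... | yes _ | no _     = cong suc (count-remove u x∈ys px)
  ... | no _  | no _     = count-remove u x∈ys px

module _ {A : Set} where

  sum-map-+ : (f g : A → ℕ) → ∀ xs → sum (map (λ a → f a + g a) xs) ≡ sum (map f xs) + sum (map g xs)
  sum-map-+ f g []       = refl
  sum-map-+ f g (a ∷ xs) = trans (cong (f a + g a +_) (sum-map-+ f g xs)) (interchange (f a) (g a) _ _)

  sum-const : (f : A → ℕ) (c : ℕ) → ∀ xs → (∀ a → a ∈ₗ xs → f a ≡ c) →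
    sum (map f xs) ≡ length xs * c
  sum-const f c []       _     = refl
  sum-const f c (a ∷ xs) f≡c =
    cong₂ _+_ (f≡c a (here refl)) (sum-const f c xs (λ b b∈xs → f≡c b (there b∈xs)))

  sum-bound : (f : A → ℕ) (c : ℕ) → ∀ xs → (∀ a → a ∈ₗ xs → f a ≤ c) →
    sum (map f xs) ≤ c * length xs
  sum-bound f c []       _     = z≤n
  sum-bound f c (a ∷ xs) f≤c =
    ≤-trans (+-mono-≤ (f≤c a (here refl)) (sum-bound f c xs (λ b b∈xs → f≤c b (there b∈xs))))
            (≤-reflexive (sym (*-suc c (length xs))))

  sum-indicator : {Q : A → Set} (Q? : ∀ a → Dec (Q a)) (f : A → ℕ) (c : ℕ) →
    (∀ a → Q a → f a ≡ c) → (∀ a → ¬ Q a → f a ≡ 0) → ∀ xs → sum (map f xs) ≡ c * count Q? xs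
  sum-indicator Q? f c onQ offQ []       = sym (*-zeroʳ c)
  sum-indicator Q? f c onQ offQ (a ∷ xs) with Q? a
  ... | yes qa = trans (cong₂ _+_ (onQ a qa) (sum-indicator Q? f c onQ offQ xs)) (sym (*-suc c _))
  ... | no ¬qa = cong₂ _+_ (offQ a ¬qa) (sum-indicator Q? f c onQ offQ xs)

  sum-except-one : (f : A → ℕ) (c d : ℕ) {s : A} → ∀ xs → Unique xs → s ∈ₗ xs → f s ≤ d →
    (∀ a → a ∈ₗ xs → a ≢ s → f a ≤ c) → sum (map f xs) + c ≤ d + c * length xs
  sum-except-one f c d (s ∷ xs) (s∉xs ∷ _) (here refl) fs≤d others = begin
    f s + sum (map f xs) + c  ≤⟨ +-monoˡ-≤ c (+-mono-≤ fs≤d (sum-bound f c xs rest≤c)) ⟩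
    d + c * length xs + c     ≡⟨ +-assoc d _ c ⟩
    d + (c * length xs + c)   ≡⟨ cong (d +_) (trans (+-comm _ c) (sym (*-suc c _))) ⟩
    d + c * suc (length xs)   ∎
    where
      open ≤-Reasoning
      rest≤c : ∀ a → a ∈ₗ xs → f a ≤ c
      rest≤c a a∈xs = others a (there a∈xs) (λ a≡s → All.lookup s∉xs a∈xs (sym a≡s))
  sum-except-one f c d (a ∷ xs) (a∉xs ∷ u) (there s∈xs) fs≤d others = begin
    f a + sum (map f xs) + c   ≡⟨ +-assoc (f a) _ c ⟩
    f a + (sum (map f xs) + c) ≤⟨ +-mono-≤ (others a (here refl) (λ a≡s → All.lookup a∉xs s∈xs a≡s)) rest ⟩
    c + (d + c * length xs)    ≡⟨ x∙yz≈y∙xz c d _ ⟩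
    d + (c + c * length xs)    ≡⟨ cong (d +_) (sym (*-suc c _)) ⟩
    d + c * suc (length xs)    ∎
    where
      open ≤-Reasoning
      rest : sum (map f xs) + c ≤ d + c * length xs
      rest = sum-except-one f c d xs u s∈xs fs≤d (λ b b∈xs → others b (there b∈xs))

double-count : {A B : Set} {R : A → B → Set} (R? : ∀ a b → Dec (R a b)) → ∀ as bs →
  sum (map (λ a → count (R? a) bs) as) ≡ sum (map (λ b → count (λ a → R? a b) as) bs)
double-count R? []       bs = sym (trans (sum-const (λ _ → 0) 0 bs (λ _ _ → refl)) (*-zeroʳ (length bs)))
double-count R? (a ∷ as) bs = begin
  count (R? a) bs + sum (map (λ a → count (R? a) bs) as)
    ≡⟨ cong₂ _+_ (count-as-sum (R? a) bs) (double-count R? as bs) ⟩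
  sum (map (λ b → indicator (R? a b)) bs) + sum (map (λ b → count (λ a → R? a b) as) bs)
    ≡⟨ sum-map-+ (λ b → indicator (R? a b)) (λ b → count (λ a → R? a b) as) bs ⟨
  sum (map (λ b → indicator (R? a b) + count (λ a → R? a b) as) bs)
    ≡⟨ cong sum (map-cong (λ b → count-∷ (λ a → R? a b) a as) bs) ⟨
  sum (map (λ b → count (λ a → R? a b) (a ∷ as)) bs) ∎
  where open ≡-Reasoning

-- The number in  Exactly P n  is determined: every duplicate-free list of the
-- objects satisfying P has length n (it is a permutation of the given one).
exactly-length : {A : Set} {P : A → Set} {n : ℕ} → Exactly P n →
  ∀ {ys} → Unique ys → (∀ a → a ∈ₗ ys ⇔ P a) → length ys ≡ n
exactly-length (xs , xs-unique , ∈xs⇔P , length-xs) {ys} ys-unique ∈ys⇔P =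
  trans (↭-length (∼bag⇒↭ (unique∧set⇒bag ys-unique xs-unique same-members))) length-xs
  where
    same-members : ∀ {a} → a ∈ₗ ys ⇔ a ∈ₗ xs
    same-members {a} = mk⇔ (from (∈xs⇔P a) ∘ to (∈ys⇔P a)) (from (∈ys⇔P a) ∘ to (∈xs⇔P a))

count-tabulate : ∀ {n} {A : Set} {P : A → Set} (P? : ∀ a → Dec (P a)) (f : Fin n → A) →
  count P? (tabulate f) ≡ count (λ i → P? (f i)) (allFin n)
count-tabulate {zero}  P? f = refl
count-tabulate {suc n} P? f = begin
  count P? (tabulate f)
    ≡⟨ count-∷ P? (f zero) (tabulate (λ i → f (suc i))) ⟩
  indicator (P? (f zero)) + count P? (tabulate (λ i → f (suc i)))
    ≡⟨ cong (indicator (P? (f zero)) +_) (count-tabulate P? (λ i → f (suc i))) ⟩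
  indicator (P? (f zero)) + count (λ i → P? (f (suc i))) (allFin n)
    ≡⟨ cong (indicator (P? (f zero)) +_) (count-tabulate (λ i → P? (f i)) suc) ⟨
  indicator (P? (f zero)) + count (λ i → P? (f i)) (tabulate suc)
    ≡⟨ count-∷ (λ i → P? (f i)) zero (tabulate suc) ⟨
  count (λ i → P? (f i)) (allFin (suc n)) ∎
  where open ≡-Reasoning

size-∷ : ∀ {n} s (p : Subset n) → ∣ s ∷ p ∣ ≡ indicator (zero ∈? s ∷ p) + ∣ p ∣
size-∷ inside  p = refl
size-∷ outside p = refl

size-as-count : ∀ {n} (p : Subset n) → ∣ p ∣ ≡ count (_∈? p) (allFin n)
size-as-count {zero}  []      = refl
size-as-count {suc n} (s ∷ p) = begin
  ∣ s ∷ p ∣                                               ≡⟨ size-∷ s p ⟩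
  head + ∣ p ∣                                            ≡⟨ cong (head +_) (size-as-count p) ⟩
  head + count (_∈? p) (allFin n)                         ≡⟨ cong (head +_) shift ⟩
  head + count (λ i → suc i ∈? s ∷ p) (allFin n)          ≡⟨ cong (head +_) (count-tabulate (_∈? s ∷ p) suc) ⟨
  head + count (_∈? s ∷ p) (tabulate suc)                 ≡⟨ count-∷ (_∈? s ∷ p) zero (tabulate suc) ⟨
  count (_∈? s ∷ p) (allFin (suc n))                      ∎
  where
    open ≡-Reasoning
    head : ℕ
    head = indicator (zero ∈? s ∷ p)
    shift : count (_∈? p) (allFin n) ≡ count (λ i → suc i ∈? s ∷ p) (allFin n)
    shift = count-cong (_∈? p) (λ i → suc i ∈? s ∷ p) (allFin n) (λ _ _ → vthere) (λ _ _ → drop-there)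

others? : ∀ {n} (p : Subset n) (x : Fin n) (y : Fin n) → Dec (y ∈ p × y ≢ x)
others? p x y = y ∈? p ×-dec ¬? (y ≟ x)

count-others : ∀ {n} {p : Subset n} {x} → x ∈ p → count (others? p x) (allFin n) ≡ ∣ p ∣ ∸ 1
count-others {n} {p} {x} x∈p = begin
  count (others? p x) (allFin n)           ≡⟨ m+n∸n≡m _ 1 ⟨
  count (others? p x) (allFin n) + 1 ∸ 1   ≡⟨ cong (_∸ 1) (+-comm _ 1) ⟩
  suc (count (others? p x) (allFin n)) ∸ 1
    ≡⟨ cong (_∸ 1) (count-remove _≟_ (_∈? p) (allFin⁺ n) (∈-allFin x) x∈p) ⟩
  count (_∈? p) (allFin n) ∸ 1             ≡⟨ cong (_∸ 1) (size-as-count p) ⟨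
  ∣ p ∣ ∸ 1                                ∎
  where open ≡-Reasoning

nonempty : ∀ {n} {p : Subset n} → 0 < ∣ p ∣ → Nonempty p
nonempty {n} {p} pos with nonempty? p
... | yes ne    = ne
... | no  empty = contradiction (trans (cong ∣_∣ (Empty-unique empty)) (∣⊥∣≡0 n)) (>⇒≢ pos)

two-distinct : ∀ {n} {p : Subset n} → 2 ≤ ∣ p ∣ → ∃₂ λ x y → x ∈ p × y ∈ p × x ≢ y
two-distinct {n} {p} 2≤∣p∣ with nonempty (≤-trans (s≤s z≤n) 2≤∣p∣)
... | x , x∈p with count-witness (others? p x) (allFin n)
                     (≤-trans (∸-monoˡ-≤ 1 2≤∣p∣) (≤-reflexive (sym (count-others x∈p))))
... | y , _ , y∈p , y≢x = x , y , x∈p , y∈p , λ x≡y → y≢x (sym x≡y)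

⊆-size⇒≡ : ∀ {n} {p q : Subset n} → p ⊆ q → ∣ q ∣ ≤ ∣ p ∣ → p ≡ q
⊆-size⇒≡ {p = p} {q} p⊆q ∣q∣≤∣p∣ = ⊆-antisym p⊆q q⊆p
  where
    q⊆p : q ⊆ p
    q⊆p {y} y∈q with y ∈? p
    ... | yes y∈p = y∈p
    ... | no  y∉p = contradiction (p⊂q⇒∣p∣<∣q∣ (p⊆q , y , y∈q , y∉p)) (≤⇒≯ ∣q∣≤∣p∣)

module _ {v b : ℕ} (blocks : Fin b → Subset v) where

  pair? : (B' : Subset b) (x y : Fin v) → ∀ i → Dec (i ∈ B' × (x ∈ blocks i × y ∈ blocks i))
  pair? B' x y i = i ∈? B' ×-dec (x ∈? blocks i ×-dec y ∈? blocks i)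

  covering-block : ∀ {B' x y} → pairCount blocks B' x y ≡ 1 →
    ∃ λ i → i ∈ B' × x ∈ blocks i × y ∈ blocks i
  covering-block {B'} {x} {y} once with count-witness (pair? B' x y) (allFin b) (≤-reflexive (sym once))
  ... | i , _ , i∈B' , x∈i , y∈i = i , i∈B' , x∈i , y∈i

module Design {v k b : ℕ} {blocks : Fin b → Subset v} (bibd : IsBIBD v k 1 b blocks) where
  open IsBIBD bibd

  1<v : 1 < v
  1<v = <-trans k>1 k<v

  block-through : ∀ {x y} → x ≢ y → ∃ λ i → x ∈ blocks i × y ∈ blocks i
  block-through {x} {y} x≢y with covering-block blocks (balanced x y x≢y)
  ... | i , _ , x∈i , y∈i = i , x∈i , y∈i

  unique-block : ∀ {x y i j} → x ≢ y →
    x ∈ blocks i → y ∈ blocks i → x ∈ blocks j → y ∈ blocks j → i ≡ j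
  unique-block {x} {y} {i} {j} x≢y x∈i y∈i x∈j y∈j =
    count≤1⇒unique _≟_ (pair? blocks ⊤ x y) (≤-reflexive (balanced x y x≢y))
      (∈-allFin i) (∈⊤ , x∈i , y∈i) (∈-allFin j) (∈⊤ , x∈j , y∈j)

  sub-contains-block : ∀ {S x y i} → IsSubBIBD blocks S → x ∈ proj₁ S → y ∈ proj₁ S → x ≢ y →
    x ∈ blocks i → y ∈ blocks i → i ∈ proj₂ S
  sub-contains-block (_ , covers) x∈S y∈S x≢y x∈i y∈i with covering-block blocks (covers _ _ x∈S y∈S x≢y)
  ... | j , j∈S , x∈j , y∈j = subst (_∈ _) (sym (unique-block x≢y x∈i y∈i x∈j y∈j)) j∈S

  -- The blocks of a sub-BIBD are determined by its points (every block has two points).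
  same-points⇒same-blocks : ∀ {S T} → IsSubBIBD blocks S → IsSubBIBD blocks T →
    proj₁ S ≡ proj₁ T → proj₂ S ⊆ proj₂ T
  same-points⇒same-blocks {S} {T} sS sT S₁≡T₁ {j} j∈S
    with two-distinct (subst (2 ≤_) (sym (blockSize j)) k>1)
  ... | x , y , x∈j , y∈j , x≢y = sub-contains-block sT (inT x∈j) (inT y∈j) x≢y x∈j y∈j
    where
      inT : ∀ {z} → z ∈ blocks j → z ∈ proj₁ T
      inT z∈j = subst (_ ∈_) S₁≡T₁ (proj₁ sS j j∈S z∈j)

  ∩-sub : ∀ {S T} → IsSubBIBD blocks S → IsSubBIBD blocks T →
    IsSubBIBD blocks (proj₁ S ∩ proj₁ T , proj₂ S ∩ proj₂ T)
  ∩-sub {S₁ , S₂} {T₁ , T₂} sS sT = blocks-inside , covered-once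
    where
      blocks-inside : ∀ i → i ∈ S₂ ∩ T₂ → blocks i ⊆ S₁ ∩ T₁
      blocks-inside i i∈S∩T z∈i with x∈p∩q⁻ S₂ T₂ i∈S∩T
      ... | i∈S , i∈T = x∈p∩q⁺ (proj₁ sS i i∈S z∈i , proj₁ sT i i∈T z∈i)
      covered-once : ∀ x y → x ∈ S₁ ∩ T₁ → y ∈ S₁ ∩ T₁ → x ≢ y →
        pairCount blocks (S₂ ∩ T₂) x y ≡ 1
      covered-once x y x∈S∩T y∈S∩T x≢y
        with x∈p∩q⁻ S₁ T₁ x∈S∩T | x∈p∩q⁻ S₁ T₁ y∈S∩T | block-through x≢y
      ... | x∈S , x∈T | y∈S , y∈T | i , x∈i , y∈i = ≤-antisym at-most-once at-least-once
        where
          at-most-once : pairCount blocks (S₂ ∩ T₂) x y ≤ 1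
          at-most-once = ≤-trans
            (count-mono (pair? blocks (S₂ ∩ T₂) x y) (pair? blocks ⊤ x y) (allFin b)
              (λ _ _ (_ , x,y∈i) → ∈⊤ , x,y∈i))
            (≤-reflexive (balanced x y x≢y))
          at-least-once : 1 ≤ pairCount blocks (S₂ ∩ T₂) x y
          at-least-once = count-member (pair? blocks (S₂ ∩ T₂) x y) (∈-allFin i)
            (x∈p∩q⁺ (sub-contains-block sS x∈S y∈S x≢y x∈i y∈i , sub-contains-block sT x∈T y∈T x≢y x∈i y∈i)
             , x∈i , y∈i)

  -- Two distinct minimal sub-BIBDs meet in at most k points: a larger
  -- intersection would be a sub-BIBD that by minimality equals both.
  minimal-meet : ∀ {S T} → IsMinimalSub k blocks S → IsMinimalSub k blocks T → S ≢ T →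
    ∣ proj₁ S ∩ proj₁ T ∣ ≤ k
  minimal-meet {S₁ , S₂} {T₁ , T₂} (sS , _ , minS) (sT , _ , minT) S≢T with ∣ S₁ ∩ T₁ ∣ ≤? k
  ... | yes small = small
  ... | no  large = contradiction (cong₂ _,_ S₁≡T₁ S₂≡T₂) S≢T
    where
      I-sub : IsSubBIBD blocks (S₁ ∩ T₁ , S₂ ∩ T₂)
      I-sub = ∩-sub {S₁ , S₂} {T₁ , T₂} sS sT
      S₁≡T₁ : S₁ ≡ T₁
      S₁≡T₁ = trans (sym (⊆-size⇒≡ (p∩q⊆p S₁ T₁) (minS _ I-sub (≰⇒> large))))
                    (⊆-size⇒≡ (p∩q⊆q S₁ T₁) (minT _ I-sub (≰⇒> large)))
      S₂≡T₂ : S₂ ≡ T₂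
      S₂≡T₂ = ⊆-antisym (same-points⇒same-blocks sS sT S₁≡T₁)
                        (same-points⇒same-blocks sT sS (sym S₁≡T₁))

m+n≤o+p⇒m∸p≤o∸n : ∀ x q p y → x + q ≤ p + y → x ∸ y ≤ p ∸ q
m+n≤o+p⇒m∸p≤o∸n x q p y x+q≤p+y = begin
  x ∸ y             ≡⟨ cong (_∸ y) (m+n∸n≡m x q) ⟨
  x + q ∸ q ∸ y     ≤⟨ ∸-monoˡ-≤ y (∸-monoˡ-≤ q x+q≤p+y) ⟩
  p + y ∸ q ∸ y     ≡⟨ ∸-+-assoc (p + y) q y ⟩
  p + y ∸ (q + y)   ≡⟨ cong₂ _∸_ (+-comm p y) (+-comm q y) ⟩
  y + p ∸ (y + q)   ≡⟨ [m+n]∸[m+o]≡n∸o y p q ⟩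
  p ∸ q             ∎
  where open ≤-Reasoning

-- The arithmetic core.  With a = v' - 1, c = k - 1, n = v - 1, the point count
-- l a = m n and the intersection count m a + c ≤ a + c l give m (a² - n c) ≤ (a - c) a.
quadratic-bound : ∀ a c n m l → l * a ≡ m * n → m * a + c ≤ a + c * l →
  m * (a ^ 2 ∸ n * c) ≤ (a ∸ c) * a
quadratic-bound a c n m l point meet = begin
  m * (a ^ 2 ∸ n * c)        ≡⟨ cong (λ t → m * (a * t ∸ n * c)) (*-identityʳ a) ⟩
  m * (a * a ∸ n * c)        ≡⟨ *-distribˡ-∸ m (a * a) (n * c) ⟩
  m * (a * a) ∸ m * (n * c)  ≤⟨ m+n≤o+p⇒m∸p≤o∸n (m * (a * a)) (c * a) (a * a) (m * (n * c)) scaled ⟩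
  a * a ∸ c * a              ≡⟨ *-distribʳ-∸ a a c ⟨
  (a ∸ c) * a                ∎
  where
    open ≤-Reasoning
    factor : ∀ m a c → m * (a * a) + c * a ≡ (m * a + c) * a
    factor = solve-∀
    expand : ∀ a c l → (a + c * l) * a ≡ a * a + c * (l * a)
    expand = solve-∀
    rotate : ∀ c m n → c * (m * n) ≡ m * (n * c)
    rotate = solve-∀
    scaled : m * (a * a) + c * a ≤ a * a + m * (n * c)
    scaled = begin
      m * (a * a) + c * a   ≡⟨ factor m a c ⟩
      (m * a + c) * a       ≤⟨ *-monoˡ-≤ a meet ⟩
      (a + c * l) * a       ≡⟨ expand a c l ⟩
      a * a + c * (l * a)   ≡⟨ cong (λ t → a * a + c * t) point ⟩
      a * a + c * (m * n)   ≡⟨ cong (a * a +_) (rotate c m n) ⟩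
      a * a + m * (n * c)   ∎

module Around {v k b : ℕ} {blocks : Fin b → Subset v} (bibd : IsBIBD v k 1 b blocks)
              {l m v' : ℕ} (wd : WellDistributed k blocks l m)
              (size : ∀ S → IsMinimalSub k blocks S → ∣ proj₁ S ∣ ≡ v') (x : Fin v) where
  open Design bibd

  Minimal : SubCand v b → Set
  Minimal = IsMinimalSub k blocks

  through : List (SubCand v b)
  through = proj₁ (proj₁ wd x)

  through-unique : Unique through
  through-unique = proj₁ (proj₂ (proj₁ wd x))

  ∈-through : ∀ T → T ∈ₗ through ⇔ (Minimal T × x ∈ proj₁ T)
  ∈-through = proj₁ (proj₂ (proj₂ (proj₁ wd x)))

  length-through : length through ≡ l
  length-through = proj₂ (proj₂ (proj₂ (proj₁ wd x)))

  -- Every other point y lies in exactly m of them: these are precisely the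
  -- minimal sub-BIBDs containing the block through x and y.
  degree : ∀ {y} → y ≢ x → count (λ T → y ∈? proj₁ T) through ≡ m
  degree {y} y≢x with block-through (λ x≡y → y≢x (sym x≡y))
  ... | i , x∈i , y∈i = exactly-length (proj₂ wd i) (filter⁺ y∈? through-unique) same-members
    where
      y∈? : ∀ T → Dec (y ∈ proj₁ T)
      y∈? T = y ∈? proj₁ T
      same-members : ∀ T → T ∈ₗ filter y∈? through ⇔ (Minimal T × i ∈ proj₂ T)
      same-members T = mk⇔ into back
        where
          into : T ∈ₗ filter y∈? through → Minimal T × i ∈ proj₂ T
          into T∈ with ∈-filter⁻ y∈? T∈
          ... | T∈through , y∈T with to (∈-through T) T∈through
          ... | minT , x∈T = minT , sub-contains-block (proj₁ minT) x∈T y∈T (λ x≡y → y≢x (sym x≡y)) x∈i y∈i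
          back : Minimal T × i ∈ proj₂ T → T ∈ₗ filter y∈? through
          back (minT , i∈T) = ∈-filter⁺ y∈? (from (∈-through T) (minT , inT x∈i)) (inT y∈i)
            where
              inT : ∀ {z} → z ∈ blocks i → z ∈ proj₁ T
              inT = proj₁ (proj₁ minT) i i∈T

  shared : Subset v → SubCand v b → ℕ
  shared q T = count (others? (q ∩ proj₁ T) x) (allFin v)

  -- Double counting the pairs (T, y) with T through x and y ≠ x a point of q ∩ T:
  -- each such y of q lies in m members T.
  incidences : ∀ q → sum (map (shared q) through) ≡ m * count (others? q x) (allFin v)
  incidences q = trans (double-count (λ T → others? (q ∩ proj₁ T) x) through (allFin v))
                       (sum-indicator (others? q x) _ m in-q not-in-q (allFin v))
    where
      in-q : ∀ y → y ∈ q × y ≢ x → count (λ T → others? (q ∩ proj₁ T) x y) through ≡ m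
      in-q y (y∈q , y≢x) = trans
        (count-cong _ (λ T → y ∈? proj₁ T) through
          (λ T _ (y∈q∩T , _) → proj₂ (x∈p∩q⁻ q (proj₁ T) y∈q∩T))
          (λ _ _ y∈T → x∈p∩q⁺ (y∈q , y∈T) , y≢x))
        (degree y≢x)
      not-in-q : ∀ y → ¬ (y ∈ q × y ≢ x) → count (λ T → others? (q ∩ proj₁ T) x y) through ≡ 0
      not-in-q y ¬[y∈q×y≢x] = count-none _ through
        (λ T _ (y∈q∩T , y≢x) → ¬[y∈q×y≢x] (proj₁ (x∈p∩q⁻ q (proj₁ T) y∈q∩T) , y≢x))

  shared-size : ∀ {q T} → x ∈ q → T ∈ₗ through → shared q T ≡ ∣ q ∩ proj₁ T ∣ ∸ 1
  shared-size {q} {T} x∈q T∈through = count-others (x∈p∩q⁺ (x∈q , proj₂ (to (∈-through T) T∈through)))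

  point-count : l * (v' ∸ 1) ≡ m * (v ∸ 1)
  point-count = begin
    l * (v' ∸ 1)                       ≡⟨ cong (_* (v' ∸ 1)) length-through ⟨
    length through * (v' ∸ 1)          ≡⟨ sum-const (shared ⊤) (v' ∸ 1) through each ⟨
    sum (map (shared ⊤) through)       ≡⟨ incidences ⊤ ⟩
    m * count (others? ⊤ x) (allFin v) ≡⟨ cong (m *_) (trans (count-others {v} {⊤} ∈⊤) (cong (_∸ 1) (∣⊤∣≡n v))) ⟩
    m * (v ∸ 1)                        ∎
    where
      open ≡-Reasoning
      each : ∀ T → T ∈ₗ through → shared ⊤ T ≡ v' ∸ 1
      each T T∈through = trans (shared-size ∈⊤ T∈through) (cong (_∸ 1) (begin
        ∣ ⊤ ∩ proj₁ T ∣  ≡⟨ cong ∣_∣ (∩-identityˡ (proj₁ T)) ⟩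
        ∣ proj₁ T ∣      ≡⟨ size T (proj₁ (to (∈-through T) T∈through)) ⟩
        v'               ∎))

  -- Second count (q = a minimal S through x), bounding the members T ≢ S by
  -- minimal-meet:  m (v' - 1) ≤ (v' - 1) + (k - 1) (l - 1).
  meet-count : ∀ {S} → Minimal S → x ∈ proj₁ S → m * (v' ∸ 1) + (k ∸ 1) ≤ (v' ∸ 1) + (k ∸ 1) * l
  meet-count {S} minS x∈S = begin
    m * (v' ∸ 1) + (k ∸ 1)                     ≡⟨ cong (λ t → m * t + (k ∸ 1)) S-others ⟨
    m * count (others? S₁ x) (allFin v) + (k ∸ 1) ≡⟨ cong (_+ (k ∸ 1)) (incidences S₁) ⟨
    sum (map (shared S₁) through) + (k ∸ 1)
      ≤⟨ sum-except-one (shared S₁) (k ∸ 1) (v' ∸ 1) through through-unique S∈through S-term other-terms ⟩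
    (v' ∸ 1) + (k ∸ 1) * length through        ≡⟨ cong (λ t → (v' ∸ 1) + (k ∸ 1) * t) length-through ⟩
    (v' ∸ 1) + (k ∸ 1) * l                     ∎
    where
      open ≤-Reasoning
      S₁ : Subset v
      S₁ = proj₁ S
      S∈through : S ∈ₗ through
      S∈through = from (∈-through S) (minS , x∈S)
      S-others : count (others? S₁ x) (allFin v) ≡ v' ∸ 1
      S-others = trans (count-others x∈S) (cong (_∸ 1) (size S minS))
      S-term : shared S₁ S ≤ v' ∸ 1
      S-term = begin
        shared S₁ S         ≡⟨ shared-size x∈S S∈through ⟩
        ∣ S₁ ∩ S₁ ∣ ∸ 1     ≤⟨ ∸-monoˡ-≤ 1 (∣p∩q∣≤∣p∣ S₁ S₁) ⟩
        ∣ S₁ ∣ ∸ 1          ≡⟨ cong (_∸ 1) (size S minS) ⟩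
        v' ∸ 1              ∎
      other-terms : ∀ T → T ∈ₗ through → T ≢ S → shared S₁ T ≤ k ∸ 1
      other-terms T T∈through T≢S = ≤-trans (≤-reflexive (shared-size x∈S T∈through))
        (∸-monoˡ-≤ 1 (minimal-meet minS (proj₁ (to (∈-through T) T∈through)) (λ S≡T → T≢S (sym S≡T))))

  -- Either some minimal sub-BIBD passes through x, or there are none (l = 0)
  -- and then the first count forces m = 0, as v > 1.
  minimal-through : (∃ λ S → Minimal S × x ∈ proj₁ S) ⊎ m ≡ 0
  minimal-through with l ≟ℕ 0
  ... | yes l≡0 = inj₂ (m*n≡0⇒m≡0 m (v ∸ 1) {{>-nonZero (m<n⇒0<n∸m 1<v)}}
                          (trans (sym point-count) (cong (_* (v' ∸ 1)) l≡0)))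
  ... | no  l≢0 with nonempty-list (≤-trans (n≢0⇒n>0 l≢0) (≤-reflexive (sym length-through)))
  ...   | S , S∈through = inj₁ (S , to (∈-through S) S∈through)

-- The hypothesis (v-1)(k-1) < (v'-1)² only makes the paper's denominator
-- positive; with truncated subtraction the inequality holds regardless.
lemma2p17 : (v k b : ℕ) (blocks : Fin b → Subset v) (v' l m : ℕ) →
    IsBIBD v k 1 b blocks →
    WellDistributed k blocks l m →
    (∀ S → IsMinimalSub k blocks S → ∣ proj₁ S ∣ ≡ v') →
    (v ∸ 1) * (k ∸ 1) < (v' ∸ 1) ^ 2 →
    m * ((v' ∸ 1) ^ 2 ∸ (v ∸ 1) * (k ∸ 1)) ≤ (v' ∸ k) * (v' ∸ 1)
lemma2p17 v k b blocks v' l m bibd wd size _ =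
  subst (λ t → m * ((v' ∸ 1) ^ 2 ∸ (v ∸ 1) * (k ∸ 1)) ≤ t * (v' ∸ 1)) v'-1-[k-1] bound
  where
    open IsBIBD bibd using (k>1)
    x : Fin v
    x = fromℕ< (<-trans (s≤s z≤n) (Design.1<v bibd))
    open Around bibd wd size x
    bound : m * ((v' ∸ 1) ^ 2 ∸ (v ∸ 1) * (k ∸ 1)) ≤ (v' ∸ 1 ∸ (k ∸ 1)) * (v' ∸ 1)
    bound with minimal-through
    ... | inj₁ (S , minS , x∈S) = quadratic-bound (v' ∸ 1) (k ∸ 1) (v ∸ 1) m l point-count (meet-count minS x∈S)
    ... | inj₂ m≡0 = subst (λ m → m * ((v' ∸ 1) ^ 2 ∸ (v ∸ 1) * (k ∸ 1)) ≤ _) (sym m≡0) z≤n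
    v'-1-[k-1] : v' ∸ 1 ∸ (k ∸ 1) ≡ v' ∸ k
    v'-1-[k-1] = trans (∸-+-assoc v' 1 (k ∸ 1)) (cong (v' ∸_) (m+[n∸m]≡n (<⇒≤ k>1)))
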